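{- Let $G=(V,E)$ be a directed graph, $s\neq t$ vertices, $k$ a positive integer, and $(u,v)\in E$. If $(u,v)$ is an edge of $SPG_k(s,t)$, then there exist nonnegative integers $k_f,k_b$ such that $EV^\ast_{k_f}(s,u)$ and $EV^\ast_{k_b}(v,t)$ both exist, (1) $k_f+1+k_b\le k$, and (2) $EV^\ast_{k_f}(s,u)\cap EV^\ast_{k_b}(v,t)=\emptyset$. The converse does not hold in general: there exist $G,s,t,k$ and an edge $(u,v)$ for which such $k_f,k_b$ exist but $(u,v)$ is not an edge of $SPG_k(s,t)$.
   Context: Let $G=(V,E)$ be a directed graph. A path from $x$ to $y$ is a vertex sequence $x=v_0,\ldots,v_l=y$ with $(v_{i-1},v_i)\in E$; its length is $l$ (the trivial path of length $0$ from $x$ to $x$ is allowed); $V(p)$ is its vertex set. A path is simple if its vertices are pairwise distinct. $P_l^\ast(x,y)$ is the set of simple paths from $x$ to $y$ of length at most $l$. $SPG_k(s,t)$ is the subgraph of $G$ formed by the union of vertices and edges of all simple $s$-$t$ paths of length at most $k$. Essential vertices: for query vertices $s,t$, $EV_l^\ast(s,u)=\bigcap\{V(p): p\in P_l^\ast(s,u),\ t\notin V(p)\}$ and $EV_l^\ast(v,t)=\bigcap\{V(p): p\in P_l^\ast(v,t),\ s\notin V(p)\}$. $EV_l^\ast(s,u)$ is said to exist iff there is at least one $p\in P_l^\ast(s,u)$ with $t\notin V(p)$ (similarly, $EV_l^\ast(v,t)$ exists iff some $p\in P_l^\ast(v,t)$ has $s\notin V(p)$). -}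

module Defs where

open import Data.Nat using (ℕ; zero; suc; _+_; _≤_)
open import Data.Fin using (Fin)
open import Data.Bool using (Bool; true)
open import Data.List using (List; []; _∷_)
open import Data.List.Membership.Propositional using (_∈_; _∉_)
open import Data.List.Relation.Unary.Unique.Propositional using (Unique)
open import Data.Product using (Σ; ∃; ∃-syntax; _×_; _,_)
open import Relation.Binary.PropositionalEquality using (_≡_)
open import Relation.Nullary using (¬_)

Graph : ℕ → Set
Graph n = Fin n → Fin n → Bool

module _ {n : ℕ} (G : Graph n) where

  -- A path from x to y (a walk; vertices may repeat). The trivial path [] : Path x x
  -- has length 0.
  data Path : Fin n → Fin n → Set where
    []  : ∀ {x} → Path x x
    _∷_ : ∀ {x y z} → G x y ≡ true → Path y z → Path x z

  len : ∀ {x y} → Path x y → ℕ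
  len []      = 0
  len (_ ∷ p) = suc (len p)

  verts : ∀ {x y} → Path x y → List (Fin n)
  verts {x} []      = x ∷ []
  verts {x} (_ ∷ p) = x ∷ verts p

  _∈V_ : ∀ {x y} → Fin n → Path x y → Set
  w ∈V p = w ∈ verts p

  Simple : ∀ {x y} → Path x y → Set
  Simple p = Unique (verts p)

  InP* : ℕ → ∀ {x y} → Path x y → Set
  InP* l p = Simple p × len p ≤ l

  data EdgeOn (a b : Fin n) : ∀ {x y} → Path x y → Set where
    here  : ∀ {y z} (e : G a y ≡ true) (p : Path y z) → y ≡ b → EdgeOn a b (e ∷ p)
    there : ∀ {x y z} (e : G x y ≡ true) {p : Path y z} → EdgeOn a b p → EdgeOn a b (e ∷ p)

  EdgeOfSPG : ℕ → Fin n → Fin n → Fin n → Fin n → Set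
  EdgeOfSPG k s t u v = Σ (Path s t) λ p → InP* k p × EdgeOn u v p

  -- Forward essential vertices w.r.t. query (s,t):
  -- w ∈ EV*_l(s,u)  iff  w ∈ V(p) for all p ∈ P*_l(s,u) with t ∉ V(p)
  InEVf : (s t : Fin n) → ℕ → Fin n → Fin n → Set
  InEVf s t l u w = (p : Path s u) → InP* l p → ¬ (t ∈V p) → w ∈V p

  EVfExists : (s t : Fin n) → ℕ → Fin n → Set
  EVfExists s t l u = Σ (Path s u) λ p → InP* l p × ¬ (t ∈V p)

  -- Backward essential vertices: w ∈ EV*_l(v,t) iff w ∈ V(p) for all
  -- p ∈ P*_l(v,t) with s ∉ V(p)
  InEVb : (s t : Fin n) → ℕ → Fin n → Fin n → Set
  InEVb s t l v w = (p : Path v t) → InP* l p → ¬ (s ∈V p) → w ∈V p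

  EVbExists : (s t : Fin n) → ℕ → Fin n → Set
  EVbExists s t l v = Σ (Path v t) λ p → InP* l p × ¬ (s ∈V p)

  Cond : (s t : Fin n) (k : ℕ) (u v : Fin n) (kf kb : ℕ) → Set
  Cond s t k u v kf kb =
    EVfExists s t kf u × EVbExists s t kb v
    × (kf + 1 + kb ≤ k)
    × (¬ (∃[ w ] (InEVf s t kf u w × InEVb s t kb v w)))

-- Split a simple s–t path of length ≤ k at the edge (u, v) into its prefix from s to u
-- and its suffix from v to t. Both halves are simple and disjoint, so the prefix avoids t,
-- the suffix avoids s, and their lengths serve as k_f and k_b. An essential vertex lies on
-- every admissible path, in particular on the prefix resp. the suffix, so the two essential
-- sets cannot meet.
module Submission where

open import Defs
open import Data.Nat using (ℕ; _≤_; suc; _+_; s≤s; z≤n)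
open import Data.Nat.Properties using (≤-refl)
open import Data.Fin using (Fin; zero; suc; _≟_)
open import Data.Fin.Properties using (all?)
open import Data.Bool using (true; false)
open import Data.List using (List; []; _∷_; _++_)
open import Data.List.Relation.Unary.Any using (here; there)
open import Data.List.Relation.Unary.All using (lookup)
import Data.List.Relation.Unary.All.Properties as All
open import Data.List.Relation.Unary.AllPairs using ([]; _∷_)
open import Data.List.Relation.Unary.Unique.Propositional using (Unique)
open import Data.List.Relation.Binary.Disjoint.Propositional using (Disjoint)
open import Data.Product using (Σ; ∃-syntax; _×_; _,_)
open import Data.Sum using (_⊎_; inj₁; inj₂)
open import Relation.Binary.PropositionalEquality using (_≡_; _≢_; refl; sym; subst; cong)
open import Relation.Nullary using (¬_; yes; no; contradiction)
open import Relation.Nullary.Decidable using (from-yes; from-no; ¬?; _×-dec_)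

Unique-++⁻ : ∀ {a} {A : Set a} (xs : List A) {ys : List A} →
             Unique (xs ++ ys) → Unique xs × Unique ys × Disjoint xs ys
Unique-++⁻ []       ys!         = [] , ys! , λ { (() , _) }
Unique-++⁻ (x ∷ xs) (x∉ ∷ xsys!) with Unique-++⁻ xs xsys!
... | xs! , ys! , xs#ys = All.++⁻ˡ xs x∉ ∷ xs! , ys! , λ
  { (here refl , w∈ys) → lookup (All.++⁻ʳ xs x∉) w∈ys refl
  ; (there w∈xs , w∈ys) → xs#ys (w∈xs , w∈ys) }

module _ {n : ℕ} (G : Graph n) where

  source∈V : ∀ {x y} (p : Path G x y) → _∈V_ G x p
  source∈V []      = here refl
  source∈V (_ ∷ _) = here refl

  target∈V : ∀ {x y} (p : Path G x y) → _∈V_ G y p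
  target∈V []      = here refl
  target∈V (_ ∷ p) = there (target∈V p)

  split-at-edge : ∀ {u v x y} (p : Path G x y) → EdgeOn G u v p →
    Σ (Path G x u) λ p₁ → Σ (Path G v y) λ p₂ →
      verts G p ≡ verts G p₁ ++ verts G p₂ × len G p ≡ len G p₁ + 1 + len G p₂
  split-at-edge (e ∷ p) (here .e .p refl) = [] , p , refl , refl
  split-at-edge (e ∷ p) (there .e uv∈p) with split-at-edge p uv∈p
  ... | p₁ , p₂ , verts≡ , len≡ = e ∷ p₁ , p₂ , cong (_ ∷_) verts≡ , cong suc len≡

  simple-split-at-edge : ∀ {u v x y} (p : Path G x y) → Simple G p → EdgeOn G u v p →
    Σ (Path G x u) λ p₁ → Σ (Path G v y) λ p₂ →
      Simple G p₁ × Simple G p₂ × Disjoint (verts G p₁) (verts G p₂)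
      × len G p ≡ len G p₁ + 1 + len G p₂
  simple-split-at-edge p p! uv∈p with split-at-edge p uv∈p
  ... | p₁ , p₂ , verts≡ , len≡
      with Unique-++⁻ (verts G p₁) (subst Unique verts≡ p!)
  ... | p₁! , p₂! , p₁#p₂ = p₁ , p₂ , p₁! , p₂! , p₁#p₂ , len≡

  SPG-edge⇒Cond : ∀ {k s t u v} → EdgeOfSPG G k s t u v →
                  ∃[ kf ] ∃[ kb ] Cond G s t k u v kf kb
  SPG-edge⇒Cond {k} {s} {t} (p , (p! , |p|≤k) , uv∈p)
    with simple-split-at-edge p p! uv∈p
  ... | p₁ , p₂ , p₁! , p₂! , p₁#p₂ , len≡ =
    len G p₁ , len G p₂ ,
    (p₁ , p₁∈P* , t∉p₁) , (p₂ , p₂∈P* , s∉p₂) , subst (_≤ k) len≡ |p|≤k ,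
    λ { (w , w∈EVf , w∈EVb) → p₁#p₂ (w∈EVf p₁ p₁∈P* t∉p₁ , w∈EVb p₂ p₂∈P* s∉p₂) }
    where
    p₁∈P* : InP* G (len G p₁) p₁
    p₁∈P* = p₁! , ≤-refl
    p₂∈P* : InP* G (len G p₂) p₂
    p₂∈P* = p₂! , ≤-refl
    t∉p₁ : ¬ _∈V_ G t p₁
    t∉p₁ t∈p₁ = p₁#p₂ (t∈p₁ , target∈V p₂)
    s∉p₂ : ¬ _∈V_ G s p₂
    s∉p₂ s∈p₂ = p₁#p₂ (source∈V p₁ , s∈p₂)

-- The s–u paths s v u and s b u share only s and u, so EV*₂(s,u) = {s,u} misses the
-- path v b t. But every s–u path passes through v or b, and every v–t path through b,
-- so no simple s–t path uses the edge (u, v).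
module Counterexample where

  open import Data.List.Membership.DecPropositional (_≟_ {5}) using (_∈?_)
  open import Data.List.Relation.Unary.Unique.DecPropositional (_≟_ {5}) using (unique?)

  pattern S = zero
  pattern U = suc zero
  pattern V = suc (suc zero)
  pattern B = suc (suc (suc zero))
  pattern T = suc (suc (suc (suc zero)))

  H : Graph 5
  H S V = true
  H S B = true
  H U V = true
  H V U = true
  H V B = true
  H B U = true
  H B T = true
  H _ _ = false

  into-T : ∀ x → H x T ≡ true → x ≡ B
  into-T B _ = refl
  into-T S ()
  into-T U ()
  into-T V ()
  into-T T ()

  path-into-T-visits-B : ∀ {x} (p : Path H x T) → x ≢ T → _∈V_ H B p
  path-into-T-visits-B []                  x≢T = contradiction refl x≢T
  path-into-T-visits-B (_∷_ {x} {y} e p) x≢T with y ≟ T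
  ... | yes refl = here (sym (into-T x e))
  ... | no y≢T   = there (path-into-T-visits-B p y≢T)

  S-U-path-visits-V-or-B : (p : Path H S U) → _∈V_ H V p ⊎ _∈V_ H B p
  S-U-path-visits-V-or-B (_∷_ {y = V} _ p) = inj₁ (there (source∈V H p))
  S-U-path-visits-V-or-B (_∷_ {y = B} _ p) = inj₂ (there (source∈V H p))
  S-U-path-visits-V-or-B (_∷_ {y = S} () _)
  S-U-path-visits-V-or-B (_∷_ {y = U} () _)
  S-U-path-visits-V-or-B (_∷_ {y = T} () _)

  UV∉SPG : ∀ k → ¬ EdgeOfSPG H k S T U V
  UV∉SPG k (p , (p! , _) , uv∈p) with simple-split-at-edge H p p! uv∈p
  ... | p₁ , p₂ , _ , _ , p₁#p₂ , _ with S-U-path-visits-V-or-B p₁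
  ... | inj₁ V∈p₁ = p₁#p₂ (V∈p₁ , source∈V H p₂)
  ... | inj₂ B∈p₁ = p₁#p₂ (B∈p₁ , path-into-T-visits-B p₂ λ ())

  SVU SBU : Path H S U
  SVU = _∷_ {y = V} refl (refl ∷ [])
  SBU = _∷_ {y = B} refl (refl ∷ [])

  VBT : Path H V T
  VBT = _∷_ {y = B} refl (refl ∷ [])

  EV-paths-disjoint : ∀ w → ¬ (_∈V_ H w SVU × _∈V_ H w SBU × _∈V_ H w VBT)
  EV-paths-disjoint = from-yes (all? λ w →
    ¬? (w ∈? verts H SVU ×-dec w ∈? verts H SBU ×-dec w ∈? verts H VBT))

  UV-Cond : Cond H S T 5 U V 2 2
  UV-Cond =
    (SVU , SVU∈P* , from-no (T ∈? verts H SVU)) ,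
    (VBT , VBT∈P* , from-no (S ∈? verts H VBT)) ,
    ≤-refl ,
    λ { (w , w∈EVf , w∈EVb) → EV-paths-disjoint w
          ( w∈EVf SVU SVU∈P* (from-no (T ∈? verts H SVU))
          , w∈EVf SBU SBU∈P* (from-no (T ∈? verts H SBU))
          , w∈EVb VBT VBT∈P* (from-no (S ∈? verts H VBT))) }
    where
    SVU∈P* : InP* H 2 SVU
    SVU∈P* = from-yes (unique? (verts H SVU)) , ≤-refl
    SBU∈P* : InP* H 2 SBU
    SBU∈P* = from-yes (unique? (verts H SBU)) , ≤-refl
    VBT∈P* : InP* H 2 VBT
    VBT∈P* = from-yes (unique? (verts H VBT)) , ≤-refl

lemma1 : ((n : ℕ) (G : Graph n) (s t : Fin n) (k : ℕ) (u v : Fin n) →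
    s ≢ t → 1 ≤ k → G u v ≡ true →
    EdgeOfSPG G k s t u v →
    ∃[ kf ] ∃[ kb ] Cond G s t k u v kf kb)
    ×
    (∃[ n ] Σ (Graph n) λ G → ∃[ s ] ∃[ t ] ∃[ k ] ∃[ u ] ∃[ v ]
    (s ≢ t × 1 ≤ k × G u v ≡ true
    × (∃[ kf ] ∃[ kb ] Cond G s t k u v kf kb)
    × ¬ EdgeOfSPG G k s t u v))
lemma1 =
  (λ n G s t k u v _ _ _ uv∈SPG → SPG-edge⇒Cond G uv∈SPG) ,
  (5 , H , S , T , 5 , U , V , (λ ()) , s≤s z≤n , refl , (2 , 2 , UV-Cond) , UV∉SPG 5)
  where open Counterexample
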